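{- Let $n\ge 2$ and let $VQ_n$ be the $n$-dimensional varietal hypercube. Then every edge of $VQ_n$ is contained in a cycle of length $\ell$ for every integer $\ell$ with $4\le \ell\le 2^n$ and $\ell\ne 5$. Consequently, for $n\ge 3$, $VQ_n$ is $6$-edge-pancyclic, i.e. every edge lies on cycles of every length from $6$ to $2^n$.
   Context: The $n$-dimensional varietal hypercube $VQ_n$ is defined recursively on the vertex set of binary strings of length $n$. $VQ_1$ is the complete graph on the two vertices $0$ and $1$. For $n>1$, let $VQ^0_{n-1}$ (resp. $VQ^1_{n-1}$) be the graph obtained from $VQ_{n-1}$ by prefixing $0$ (resp. $1$) to every vertex label. $VQ_n$ consists of $VQ^0_{n-1}$ and $VQ^1_{n-1}$ together with the following edges: a vertex $x=0x_{n-1}x_{n-2}\cdots x_1$ and a vertex $y=1y_{n-1}y_{n-2}\cdots y_1$ are adjacent if and only if either (1) $n$ is not a multiple of $3$ and $x_{n-1}\cdots x_1=y_{n-1}\cdots y_1$, or (2) $n$ is a multiple of $3$, $x_{n-3}\cdots x_1=y_{n-3}\cdots y_1$ and $(x_{n-1}x_{n-2},y_{n-1}y_{n-2})\in\{(00,00),(01,01),(10,11),(11,10)\}$. A graph is $\ell$-edge-pancyclic if every edge lies on cycles of every length from $\ell$ to the number of vertices. Cycles are simple. -}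

module Defs where

open import Data.Nat using (ℕ; zero; suc; _%_)
open import Data.Bool using (Bool; true; false)
open import Data.Vec using (Vec; []; _∷_)
open import Data.List using (List; length; head; last)
open import Data.List.Relation.Unary.Unique.Propositional using (Unique)
open import Data.List.Relation.Unary.Linked using (Linked)
open import Data.Maybe using (just)
open import Data.Product using (_×_; ∃)
open import Data.Empty using (⊥)
open import Data.Unit using (⊤)
open import Relation.Binary.PropositionalEquality using (_≡_; _≢_)
open import Relation.Nullary using (¬_)

-- A vertex of VQ_n: a binary string x_n x_{n-1} ... x_1, stored with the
-- leading (most significant, index n) bit at the head of the vector.
Vertex : ℕ → Set
Vertex n = Vec Bool n

-- Condition (2): (x_{n-1}x_{n-2}, y_{n-1}y_{n-2}) ∈ {(00,00),(01,01),(10,11),(11,10)}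
PairRel : Bool → Bool → Bool → Bool → Set
PairRel false a₂ false b₂ = a₂ ≡ b₂
PairRel true  a₂ true  b₂ = a₂ ≢ b₂
PairRel _     _  _     _  = ⊥

-- Edges between VQ^0_{n-1} and VQ^1_{n-1} in VQ_n, where n = suc m,
-- given the suffixes x = x_{n-1}...x_1 and y = y_{n-1}...y_1.
CrossAdj : (m : ℕ) → Vertex m → Vertex m → Set
CrossAdj m x y with suc m % 3
CrossAdj m x y | suc _ = x ≡ y
CrossAdj (suc (suc k)) (a₁ ∷ a₂ ∷ r) (b₁ ∷ b₂ ∷ s) | zero = PairRel a₁ a₂ b₁ b₂ × r ≡ s
CrossAdj _ _ _ | zero = ⊥   -- unreachable: 3 ∣ n with n ≥ 1 forces n ≥ 3

-- Adjacency in the varietal hypercube VQ_n (recursive definition).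
-- VQ_0 is the single vertex with no edges; VQ_1 = K_2 arises as the case
-- n = 1 (1 is not a multiple of 3, so 0 ~ 1).
Adj : (n : ℕ) → Vertex n → Vertex n → Set
Adj zero    _ _ = ⊥
Adj (suc m) (false ∷ x) (false ∷ y) = Adj m x y
Adj (suc m) (true  ∷ x) (true  ∷ y) = Adj m x y
Adj (suc m) (false ∷ x) (true  ∷ y) = CrossAdj m x y
Adj (suc m) (true  ∷ x) (false ∷ y) = CrossAdj m y x

record CycleThroughEdge (n : ℕ) (u v : Vertex n) (ℓ : ℕ) : Set where
  field
    verts    : List (Vertex n)
    len      : length verts ≡ ℓ
    distinct : Unique verts
    path     : Linked (Adj n) verts
    startsUV : ∃ λ rest → verts ≡ u Data.List.∷ v Data.List.∷ rest
    closes   : ∃ λ w → last verts ≡ just w × Adj n w u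

module Submission where

-- VQ_{m+1} consists of two halves c ∷ VQ_m (c a bit) joined by the perfect
-- matching c ∷ x ~ (not c) ∷ ψ x, where ψ is the identity when 3 ∤ m + 1 and
-- negates the second bit of vertices with leading bit 1 when 3 ∣ m + 1.
-- Cycles of VQ_{m+1} are spliced from cycles of VQ_m copied into the two
-- halves (`fromHalves`): through a matching edge by joining a cycle in each
-- half (`crossCycle`), through an edge inside a half by replacing one edge of
-- a cycle by a detour through the other half (`replaceSecond`, `replaceLast`).
-- Lengths are split by elementary arithmetic (`splitAbove`, `splitLong`); an
-- edge traversed back and forth counts as a cycle of length 2 for this
-- purpose, and 5-cycles supply the length 7 = 5 + 2.  When ψ is the twist it
-- preserves only the edges inside the halves of VQ_m, so a twisted step needs
-- cycles that close inside the half of their first vertex ("strong" cycles),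
-- which the plain steps produce.  Induction thus runs in periods of three
-- dimensions (two plain steps, one twisted) from the base cases VQ_2 and VQ_3,
-- which are certified by an exhaustive search whose results are checked.

open import Defs
open import Data.Nat using (ℕ; zero; suc; _+_; _*_; _∸_; _≤_; _<_; _^_; _%_; _/_; _≤?_; s≤s)
import Data.Nat as ℕ
open import Data.Nat.Properties
  using (≤-refl; ≤-trans; ≤-pred; +-suc; +-identityʳ; +-cancelˡ-≤; ≰⇒>; n≤1+n; m≤m+n; m≤n+m;
         m≤n⇒∃[o]m+o≡n)
open import Data.Nat.DivMod using ([m+kn]%n≡m%n; m≡m%n+[m/n]*n; m%n<n)
open import Data.Bool using (Bool; true; false; not)
open import Data.Bool.Properties using (not-¬; ¬-not) renaming (_≟_ to _≟ᵇ_)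
open import Data.Vec using ([]; _∷_; head)
open import Data.Vec.Properties using (∷-injectiveʳ; ≡-dec)
open import Data.List as List using (List; length; map; _++_; _∷ʳ_; concatMap; filter; upTo)
open import Data.List.Properties using (length-map; length-++)
open import Data.List.Membership.Propositional using (_∈_)
open import Data.List.Membership.Propositional.Properties
  using (∈-map⁻; ∈-map⁺; ∈-++⁺ˡ; ∈-++⁺ʳ; ∈-upTo⁺)
open import Data.List.Relation.Unary.All as All using (All; _∷_; [])
open import Data.List.Relation.Unary.Any as Any using (Any; here)
open import Data.List.Relation.Unary.AllPairs using (_∷_; [])
open import Data.List.Relation.Unary.Linked using (Linked; [-]; _∷_)
open import Data.List.Relation.Unary.Unique.Propositional using (Unique)
import Data.List.Relation.Unary.Unique.Propositional.Properties as Unique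
import Data.List.Relation.Unary.Unique.DecPropositional as UniqueDec
open import Data.List.Relation.Binary.Disjoint.Propositional using (Disjoint)
open import Data.List.Relation.Binary.Permutation.Propositional using (_↭_; ↭-sym; ↭-trans; prep; ↭⇒↭ₛ)
open import Data.List.Relation.Binary.Permutation.Propositional.Properties
  using (↭-length; ++-comm; ++⁺ˡ; ∷↭∷ʳ)
import Data.List.Relation.Binary.Permutation.Propositional.Properties as Perm
import Data.List.Relation.Binary.Permutation.Setoid.Properties as PermutationSetoid
open import Data.Maybe using (just)
open import Data.Product using (Σ; _×_; _,_; proj₁; proj₂)
open import Data.Unit using (tt)
open import Data.Empty using (⊥-elim)
open import Function using (id)
open import Relation.Binary.PropositionalEquality
  using (_≡_; _≢_; refl; sym; trans; cong; cong₂; subst; setoid; module ≡-Reasoning)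
open import Relation.Nullary using (Dec; yes; no)
open import Relation.Nullary.Decidable using (True; toWitness; _×-dec_; _→-dec_; ¬?; map′)

data Walk {A : Set} (R : A → A → Set) : A → List A → A → Set where
  []  : ∀ {x} → Walk R x List.[] x
  _∷_ : ∀ {x y ys z} → R x y → Walk R y ys z → Walk R x (y List.∷ ys) z

module _ {A : Set} {R : A → A → Set} where

  _▸_▸_ : ∀ {x xs y z zs w} → Walk R x xs y → R y z → Walk R z zs w →
          Walk R x (xs ++ z List.∷ zs) w
  [] ▸ r ▸ q = r ∷ q
  (e ∷ p) ▸ r ▸ q = e ∷ (p ▸ r ▸ q)

  _▸_ : ∀ {x xs y z} → Walk R x xs y → R y z → Walk R x (xs ∷ʳ z) z
  p ▸ r = p ▸ r ▸ []

  walk⇒linked : ∀ {x xs y} → Walk R x xs y → Linked R (x List.∷ xs)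
  walk⇒linked [] = [-]
  walk⇒linked (e ∷ p) = e ∷ walk⇒linked p

  walk-last : ∀ {x xs y} → Walk R x xs y → List.last (x List.∷ xs) ≡ just y
  walk-last [] = refl
  walk-last (e ∷ []) = refl
  walk-last (e ∷ (f ∷ p)) = walk-last (f ∷ p)

walk-map : ∀ {A B : Set} {R : A → A → Set} {S : B → B → Set} (f : A → B) →
           (∀ {a b} → R a b → S (f a) (f b)) →
           ∀ {x xs y} → Walk R x xs y → Walk S (f x) (map f xs) (f y)
walk-map f g [] = []
walk-map f g (e ∷ p) = g e ∷ walk-map f g p

inHalf : ∀ {m} → Bool → List (Vertex m) → List (Vertex (suc m))
inHalf c = map (c ∷_)

adj-inHalf : ∀ m c {x y : Vertex m} → Adj m x y → Adj (suc m) (c ∷ x) (c ∷ y)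
adj-inHalf m false e = e
adj-inHalf m true e = e

pair-sym : ∀ a b c d → PairRel a b c d → PairRel c d a b
pair-sym false b false d p = sym p
pair-sym true b true d p = λ q → p (sym q)

cross-sym : ∀ m (x y : Vertex m) → CrossAdj m x y → CrossAdj m y x
cross-sym m x y p with suc m % 3
cross-sym m x y p | suc _ = sym p
cross-sym (suc (suc k)) (a ∷ b ∷ r) (c ∷ d ∷ s) (p , q) | zero = pair-sym a b c d p , sym q

adj-sym : ∀ n {x y : Vertex n} → Adj n x y → Adj n y x
adj-sym (suc m) {false ∷ x} {false ∷ y} e = adj-sym m e
adj-sym (suc m) {true ∷ x} {true ∷ y} e = adj-sym m e
adj-sym (suc m) {false ∷ x} {true ∷ y} e = e
adj-sym (suc m) {true ∷ x} {false ∷ y} e = e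

adj-irrefl : ∀ n {x y : Vertex n} → Adj n x y → x ≢ y
adj-irrefl (suc m) {false ∷ x} e refl = adj-irrefl m e refl
adj-irrefl (suc m) {true ∷ x} e refl = adj-irrefl m e refl

-- Length 2 is allowed and denotes the edge
-- uv traversed back and forth; it serves as a building block below.
record Cycle (n : ℕ) (u v : Vertex n) (ℓ : ℕ) : Set where
  constructor cycle
  field
    rest     : List (Vertex n)
    last     : Vertex n
    walk     : Walk (Adj n) u (v List.∷ rest) last
    closes   : Adj n last u
    distinct : Unique (u List.∷ v List.∷ rest)
    size     : length (u List.∷ v List.∷ rest) ≡ ℓ

  vertices : List (Vertex n)
  vertices = u List.∷ v List.∷ rest

  firstEdge : Adj n u v
  firstEdge with walk
  ... | e ∷ _ = e

open Cycle using (vertices; firstEdge)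

toCycleThroughEdge : ∀ {n u v ℓ} → Cycle n u v ℓ → CycleThroughEdge n u v ℓ
toCycleThroughEdge (cycle rest w p e uniq sz) = record
  { verts = _ ; len = sz ; distinct = uniq ; path = walk⇒linked p
  ; startsUV = rest , refl ; closes = w , walk-last p , e }

edgeCycle : ∀ n {u v} → Adj n u v → Cycle n u v 2
edgeCycle n e = cycle List.[] _ (e ∷ []) (adj-sym n e)
  ((adj-irrefl n e ∷ []) ∷ ([] ∷ [])) refl

liftCycle : ∀ m c {u v ℓ} → Cycle m u v ℓ → Cycle (suc m) (c ∷ u) (c ∷ v) ℓ
liftCycle m c {u} {v} C =
  cycle (inHalf c rest) (c ∷ last) (walk-map (c ∷_) (adj-inHalf m c) walk) (adj-inHalf m c closes)
        (Unique.map⁺ ∷-injectiveʳ distinct) (trans (length-map (c ∷_) (u List.∷ v List.∷ rest)) size)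
  where open Cycle C

unique-resp-↭ : ∀ {A : Set} {xs ys : List A} → xs ↭ ys → Unique xs → Unique ys
unique-resp-↭ {A} p = PermutationSetoid.Unique-resp-↭ (setoid A) (↭⇒↭ₛ p)

halves-unique : ∀ {m} c {X Y : List (Vertex m)} → Unique X → Unique Y →
                Unique (inHalf c X ++ inHalf (not c) Y)
halves-unique c {X} {Y} uX uY =
  Unique.++⁺ (Unique.map⁺ ∷-injectiveʳ uX) (Unique.map⁺ ∷-injectiveʳ uY) disjoint
  where
  disjoint : Disjoint (inHalf c X) (inHalf (not c) Y)
  disjoint (v∈X , v∈Y) with ∈-map⁻ (c ∷_) v∈X | ∈-map⁻ (not c ∷_) v∈Y
  ... | _ , _ , refl | _ , _ , eq = not-¬ refl (cong head eq)

fromHalves : ∀ m c {x₀ y₀ x₁ y₁ ℓ₀ ℓ₁ u v rest w}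
             (C₀ : Cycle m x₀ y₀ ℓ₀) (C₁ : Cycle m x₁ y₁ ℓ₁) →
             Walk (Adj (suc m)) u (v List.∷ rest) w → Adj (suc m) w u →
             (u List.∷ v List.∷ rest) ↭ inHalf c (vertices C₀) ++ inHalf (not c) (vertices C₁) →
             Cycle (suc m) u v (ℓ₀ + ℓ₁)
fromHalves m c {ℓ₀ = ℓ₀} {ℓ₁} {u} {v} {rest} C₀ C₁ p e perm =
  cycle rest _ p e (unique-resp-↭ (↭-sym perm) (halves-unique c (Cycle.distinct C₀) (Cycle.distinct C₁)))
    (begin
      length (u List.∷ v List.∷ rest)                    ≡⟨ ↭-length perm ⟩
      length (inHalf c V₀ ++ inHalf (not c) V₁)          ≡⟨ length-++ (inHalf c V₀) ⟩
      length (inHalf c V₀) + length (inHalf (not c) V₁)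
        ≡⟨ cong₂ _+_ (length-map _ V₀) (length-map _ V₁) ⟩
      length V₀ + length V₁                              ≡⟨ cong₂ _+_ (Cycle.size C₀) (Cycle.size C₁) ⟩
      ℓ₀ + ℓ₁                                            ∎)
  where
  open ≡-Reasoning
  V₀ V₁ : List (Vertex m)
  V₀ = vertices C₀
  V₁ = vertices C₁

inHalf-rotate : ∀ {m} c (z : Vertex m) xs → inHalf c (xs ∷ʳ z) ↭ inHalf c (z List.∷ xs)
inHalf-rotate c z xs = Perm.map⁺ (c ∷_) (↭-sym (∷↭∷ʳ z xs))

lit≤ : ∀ m n {_ : True (m ≤? n)} → m ≤ n
lit≤ m n {w} = toWitness w

data Long : ℕ → Set where
  four : Long 4
  big  : ∀ {ℓ} → 6 ≤ ℓ → Long ℓ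

data Admissible : ℕ → Set where
  two  : Admissible 2
  long : ∀ {ℓ} → Long ℓ → Admissible ℓ

-- A decomposition ℓ = a + b with A a, b admissible and a, b ≤ N: the
-- lengths of the two pieces of a spliced cycle in VQ_m, where N = 2^m.
record Split (A : ℕ → Set) (N ℓ : ℕ) : Set where
  constructor split
  field
    a b      : ℕ
    sum      : ℓ ≡ a + b
    a-good   : A a
    a≤N      : a ≤ N
    b-good   : Admissible b
    b≤N      : b ≤ N

excess≤ : ∀ N d → N + d ≤ 2 * N → d ≤ N
excess≤ N d le = +-cancelˡ-≤ N d N (subst (λ k → N + d ≤ N + k) (+-identityʳ N) le)

-- Lengths ℓ with N < ℓ ≤ 2N split as N + (ℓ - N), or as (N - 1) + (ℓ - N + 1)
-- when ℓ - N ∈ {1, 3, 5} is not admissible.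
splitAbove : ∀ {N ℓ} → 8 ≤ N → N < ℓ → ℓ ≤ 2 * N → Split (6 ≤_) N ℓ
splitAbove {suc N'} (s≤s 7≤N') N<ℓ ℓ≤2N with m≤n⇒∃[o]m+o≡n N<ℓ
... | d , refl = byExcess d (excess≤ N (suc d) (subst (_≤ 2 * N) (sym (+-suc N d)) ℓ≤2N))
  where
  N : ℕ
  N = suc N'
  6≤N' : 6 ≤ N'
  6≤N' = ≤-trans (lit≤ 6 7) 7≤N'
  -- an odd excess suc d ∈ {1, 3, 5} is not admissible; move one vertex over
  shift : ∀ d → Admissible (2 + d) → d ≤ 4 → Split (6 ≤_) N (suc N + d)
  shift d adm d≤4 =
    split N' (2 + d) (sym (trans (+-suc N' (suc d)) (cong suc (+-suc N' d)))) 6≤N' (n≤1+n N')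
          adm (≤-trans (s≤s (s≤s d≤4)) (s≤s (≤-trans (lit≤ 5 7) 7≤N')))
  keep : ∀ d → Admissible (suc d) → suc d ≤ N → Split (6 ≤_) N (suc N + d)
  keep d adm d≤N =
    split N (suc d) (sym (+-suc N d)) (s≤s (≤-trans (lit≤ 5 7) 7≤N')) ≤-refl adm d≤N
  byExcess : ∀ d → suc d ≤ N → Split (6 ≤_) N (suc N + d)
  byExcess 0 _ = shift 0 two (lit≤ 0 4)
  byExcess 1 le = keep 1 two le
  byExcess 2 _ = shift 2 (long four) (lit≤ 2 4)
  byExcess 3 le = keep 3 (long four) le
  byExcess 4 _ = shift 4 (long (big ≤-refl)) (lit≤ 4 4)
  byExcess d@(suc (suc (suc (suc (suc e))))) le = keep d (long (big (m≤m+n 6 e))) le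

dropTwo : ∀ b → Long (2 + b) → 2 + b ≢ 7 → Admissible b
dropTwo 2 four _ = two
dropTwo 4 (big _) _ = long four
dropTwo 5 (big _) ℓ≢7 = ⊥-elim (ℓ≢7 refl)
dropTwo (suc (suc (suc (suc (suc (suc e)))))) (big _) _ = long (big (m≤m+n 6 e))
dropTwo 2 (big (s≤s (s≤s (s≤s (s≤s ()))))) _
dropTwo 0 (big (s≤s (s≤s ()))) _
dropTwo 1 (big (s≤s (s≤s (s≤s ())))) _
dropTwo 3 (big (s≤s (s≤s (s≤s (s≤s (s≤s ())))))) _

splitLong : ∀ {N ℓ} → 8 ≤ N → Long ℓ → ℓ ≢ 7 → ℓ ≤ 2 * N → Split Admissible N ℓ
splitLong {N} {ℓ} 8≤N lg ℓ≢7 ℓ≤2N with ℓ ≤? 2 + N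
splitLong {N} {0} _ (big ()) _ _ | yes _
splitLong {N} {1} _ (big (s≤s ())) _ _ | yes _
splitLong {N} {suc (suc b)} 8≤N lg ℓ≢7 ℓ≤2N | yes ℓ≤2+N =
  split 2 b refl two (≤-trans (lit≤ 2 8) 8≤N) (dropTwo b lg ℓ≢7) (≤-pred (≤-pred ℓ≤2+N))
splitLong {N} {ℓ} 8≤N lg ℓ≢7 ℓ≤2N | no ℓ≰2+N
  with N<ℓ ← ≤-trans (m≤n+m (suc N) 2) (≰⇒> ℓ≰2+N)
  with split a b sum 6≤a a≤N adm-b b≤N ← splitAbove 8≤N N<ℓ ℓ≤2N
  = split a b sum (long (big 6≤a)) a≤N adm-b b≤N

EdgePancyclic : ℕ → Set
EdgePancyclic n = ∀ {u v} → Adj n u v → ∀ {ℓ} → Admissible ℓ → ℓ ≤ 2 ^ n → Cycle n u v ℓ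

ClosesIn : ∀ {m u v ℓ} → Bool → Cycle (suc m) u v ℓ → Set
ClosesIn c C = head (Cycle.last C) ≡ c

-- Both kinds of step in the recursive definition of VQ_n
-- have this shape: ψ is the identity when n ≢ 0 (mod 3), and a twist of the
-- two leading bits when 3 ∣ n.
module Splice (m : ℕ) (ψ : Vertex m → Vertex m)
              (match : ∀ c x → Adj (suc m) (c ∷ x) (not c ∷ ψ x)) where

  match⁻¹ : ∀ c x → Adj (suc m) (not c ∷ ψ x) (c ∷ x)
  match⁻¹ c x = adj-sym (suc m) {c ∷ x} {not c ∷ ψ x} (match c x)

  walkIn : ∀ c {x xs y} → Walk (Adj m) x xs y → Walk (Adj (suc m)) (c ∷ x) (inHalf c xs) (c ∷ y)
  walkIn c = walk-map (c ∷_) (adj-inHalf m c)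

  -- A cycle through the matching edge (c ∷ x, not c ∷ ψ x): a cycle
  -- x, y, … of VQ_m in half c and a cycle ψ y, ψ x, … in the other half,
  -- joined by the matching edges at x and y.
  crossCycle : ∀ c x y {ℓ₀ ℓ₁} → Cycle m x y ℓ₀ → Cycle m (ψ y) (ψ x) ℓ₁ →
               Σ (Cycle (suc m) (c ∷ x) (not c ∷ ψ x) (ℓ₀ + ℓ₁)) (ClosesIn c)
  crossCycle c x y C₀@(cycle r₀ z₀ (_ ∷ p₀) e₀ _ _) C₁@(cycle r₁ z₁ (_ ∷ p₁) e₁ _ _) =
    fromHalves m c C₀ C₁
      (match c x ∷ (walkIn (not c) (p₁ ▸ e₁) ▸ match⁻¹ c y ▸ walkIn c p₀))
      (adj-inHalf m c e₀)
      (prep _ (↭-trans (++-comm A (inHalf c (y List.∷ r₀)))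
        (++⁺ˡ (inHalf c (y List.∷ r₀)) (inHalf-rotate (not c) (ψ y) (ψ x List.∷ r₁)))))
    , refl
    where
    A : List (Vertex (suc m))
    A = inHalf (not c) (ψ x List.∷ r₁ ∷ʳ ψ y)

  -- Replacing the second edge v x₁ of a cycle u, v, x₁, … copied into half c
  -- by a detour ψ v, …, ψ x₁ through the other half; the first and the
  -- closing edge stay in half c.
  replaceSecond : ∀ c {u v ℓ₀ ℓ₁} (C : Cycle m u v ℓ₀) → 3 ≤ ℓ₀ →
                  (∀ {x₁} → Adj m v x₁ → Cycle m (ψ x₁) (ψ v) ℓ₁) →
                  Σ (Cycle (suc m) (c ∷ u) (c ∷ v) (ℓ₀ + ℓ₁)) (ClosesIn c)
  replaceSecond c (cycle List.[] _ _ _ _ refl) (s≤s (s≤s ()))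
  replaceSecond c {u} {v} C@(cycle (x₁ List.∷ r₀) _ (e₁ ∷ e₂ ∷ p₀) e₀ _ _) _ detour
    with D@(cycle r₁ _ (_ ∷ p₁) e₁' _ _) ← detour e₂ =
    fromHalves m c C D
      (adj-inHalf m c e₁ ∷ match c v ∷ (walkIn (not c) (p₁ ▸ e₁') ▸ match⁻¹ c x₁ ▸ walkIn c p₀))
      (adj-inHalf m c e₀)
      (prep _ (prep _ (↭-trans (++-comm A (inHalf c (x₁ List.∷ r₀)))
        (++⁺ˡ (inHalf c (x₁ List.∷ r₀)) (inHalf-rotate (not c) (ψ x₁) (ψ v List.∷ r₁))))))
    , refl
    where
    A : List (Vertex (suc m))
    A = inHalf (not c) (ψ v List.∷ r₁ ∷ʳ ψ x₁)

  -- Replacing the closing edge w x of a cycle x, y, …, w copied into half c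
  -- by a detour ψ x, ψ w, … through the other half.
  replaceLast : ∀ c {x y ℓ₀ ℓ₁} (C : Cycle m x y ℓ₀) → Cycle m (ψ x) (ψ (Cycle.last C)) ℓ₁ →
                Cycle (suc m) (c ∷ x) (c ∷ y) (ℓ₀ + ℓ₁)
  replaceLast c {x} {y} C@(cycle r₀ w p₀ _ _ _) D@(cycle r₁ _ (_ ∷ p₁) e₁ _ _) =
    fromHalves m c C D
      (walkIn c p₀ ▸ match c w ▸ walkIn (not c) (p₁ ▸ e₁))
      (match⁻¹ c x)
      (++⁺ˡ (inHalf c (x List.∷ y List.∷ r₀)) (inHalf-rotate (not c) (ψ x) (ψ w List.∷ r₁)))

  -- Every vertex x lies on a 5-cycle x, y, … whose first edge ψ maps to an
  -- edge.  Needed for the length 7 = 5 + 2 on matching edges.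
  Pentagons : Set
  Pentagons = ∀ x → Σ (Vertex m) λ y → Cycle m x y 5 × Adj m (ψ y) (ψ x)

  crossLong : 8 ≤ 2 ^ m → EdgePancyclic m → Pentagons →
              ∀ c x {ℓ} → Long ℓ → ℓ ≤ 2 ^ suc m →
              Σ (Cycle (suc m) (c ∷ x) (not c ∷ ψ x) ℓ) (ClosesIn c)
  crossLong 8≤N pancyclic pentagon c x {ℓ} lg ℓ≤2N with pentagon x | ℓ ℕ.≟ 7
  ... | y , C₅ , ψe | yes refl = crossCycle c x y C₅ (edgeCycle m ψe)
  ... | y , C₅ , ψe | no ℓ≢7
    with split a b refl adm-a a≤N adm-b b≤N ← splitLong 8≤N lg ℓ≢7 ℓ≤2N =
    crossCycle c x y (pancyclic (firstEdge C₅) adm-a a≤N) (pancyclic ψe adm-b b≤N)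

  byEdgeType : (onlyMatching : ∀ c {x y} → Adj (suc m) (c ∷ x) (not c ∷ y) → y ≡ ψ x) →
               {P : Vertex (suc m) → Vertex (suc m) → Set} →
               (∀ c {x y} → Adj m x y → P (c ∷ x) (c ∷ y)) →
               (∀ c x → P (c ∷ x) (not c ∷ ψ x)) →
               ∀ {u v} → Adj (suc m) u v → P u v
  byEdgeType onlyMatching inside cross {false ∷ x} {false ∷ y} e = inside false e
  byEdgeType onlyMatching inside cross {true ∷ x} {true ∷ y} e = inside true e
  byEdgeType onlyMatching inside cross {false ∷ x} {true ∷ y} e
    with refl ← onlyMatching false e = cross false x
  byEdgeType onlyMatching inside cross {true ∷ x} {false ∷ y} e
    with refl ← onlyMatching true e = cross true x

fromLong : ∀ {n} → (∀ {u v} → Adj n u v → ∀ {ℓ} → Long ℓ → ℓ ≤ 2 ^ n → Cycle n u v ℓ) →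
           EdgePancyclic n
fromLong {n} longCycle e two _ = edgeCycle n e
fromLong longCycle e (long lg) = longCycle e lg

StrongCycles : ∀ m → Vertex (suc m) → Vertex (suc m) → Set
StrongCycles m u v = ∀ {ℓ} → Long ℓ → ℓ ≤ 2 ^ suc m → Σ (Cycle (suc m) u v ℓ) (ClosesIn (head u))

StronglyPancyclic : ℕ → Set
StronglyPancyclic m = ∀ {u v} → Adj (suc m) u v → StrongCycles m u v

HasPentagons : ℕ → Set
HasPentagons n = ∀ x → Σ (Vertex n) λ y → Cycle n x y 5

liftPentagons : ∀ {m} → HasPentagons m → HasPentagons (suc m)
liftPentagons {m} pentagon (c ∷ x) with y , C ← pentagon x = c ∷ y , liftCycle m c C

-- When n = m + 1 is not a multiple of 3, the edges between the halves of
-- VQ_n join c ∷ x and (not c) ∷ x, i.e. VQ_n = VQ_m □ K₂.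
plain-cross : ∀ m j → suc m % 3 ≡ suc j → ∀ x → CrossAdj m x x
plain-cross m j n∤ x with suc m % 3 | n∤
... | suc _ | _ = refl

plain-cross-unique : ∀ m j → suc m % 3 ≡ suc j → ∀ {x y} → CrossAdj m x y → x ≡ y
plain-cross-unique m j n∤ e with suc m % 3 | n∤
... | suc _ | _ = e

plain-match : ∀ m j → suc m % 3 ≡ suc j → ∀ c x → Adj (suc m) (c ∷ x) (not c ∷ x)
plain-match m j n∤ false x = plain-cross m j n∤ x
plain-match m j n∤ true x = plain-cross m j n∤ x

plain-matched : ∀ m j → suc m % 3 ≡ suc j → ∀ c {x y} → Adj (suc m) (c ∷ x) (not c ∷ y) → y ≡ x
plain-matched m j n∤ false e = sym (plain-cross-unique m j n∤ e)
plain-matched m j n∤ true e = plain-cross-unique m j n∤ e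

-- A long cycle through
-- an edge inside a half is a cycle of VQ_m, or for ℓ > 2^m a cycle of
-- length a ≥ 6 whose second edge is replaced by a detour of length ℓ - a.
stepPlain : ∀ m j → suc m % 3 ≡ suc j → 8 ≤ 2 ^ m → EdgePancyclic m → HasPentagons m →
            StronglyPancyclic m
stepPlain m j n∤ 8≤N pancyclic pentagon =
  byEdgeType (plain-matched m j n∤) {StrongCycles m} inside
             (λ c x → crossLong 8≤N pancyclic pentagons c x)
  where
  open Splice m id (plain-match m j n∤)

  pentagons : Pentagons
  pentagons x with y , C ← pentagon x = y , C , adj-sym m (firstEdge C)

  inside : ∀ c {x y} → Adj m x y → StrongCycles m (c ∷ x) (c ∷ y)
  inside c {x} e {ℓ} lg ℓ≤2N with ℓ ≤? 2 ^ m
  ... | yes ℓ≤N = liftCycle m c (pancyclic e (long lg) ℓ≤N) , refl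
  ... | no ℓ≰N with split a b refl 6≤a a≤N adm-b b≤N ← splitAbove 8≤N (≰⇒> ℓ≰N) ℓ≤2N =
    replaceSecond c (pancyclic e (long (big 6≤a)) a≤N) (≤-trans (lit≤ 3 6) 6≤a)
                  (λ e₂ → pancyclic (adj-sym m e₂) adm-b b≤N)

-- When 3 ∣ n = k + 3, the edges between the halves of VQ_n join c ∷ x and
-- (not c) ∷ twist x, where twist negates the second bit of x if the first is 1.
twist : ∀ {k} → Vertex (suc (suc k)) → Vertex (suc (suc k))
twist (false ∷ b ∷ r) = false ∷ b ∷ r
twist (true ∷ b ∷ r) = true ∷ not b ∷ r

twist-cross : ∀ k → suc (suc (suc k)) % 3 ≡ 0 → ∀ x → CrossAdj (suc (suc k)) x (twist x)
twist-cross k 3∣n x with suc (suc (suc k)) % 3 | 3∣n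
twist-cross k 3∣n (false ∷ b ∷ r) | zero | _ = refl , refl
twist-cross k 3∣n (true ∷ b ∷ r) | zero | _ = not-¬ refl , refl

twist-cross-unique : ∀ k → suc (suc (suc k)) % 3 ≡ 0 →
                     ∀ {x y} → CrossAdj (suc (suc k)) x y → y ≡ twist x
twist-cross-unique k 3∣n {x} {y} e with suc (suc (suc k)) % 3 | 3∣n
twist-cross-unique k 3∣n {false ∷ b ∷ r} {false ∷ b' ∷ r'} (b≡b' , r≡r') | zero | _ =
  cong₂ (λ a s → false ∷ a ∷ s) (sym b≡b') (sym r≡r')
twist-cross-unique k 3∣n {true ∷ b ∷ r} {true ∷ b' ∷ r'} (b≢b' , r≡r') | zero | _ =
  cong₂ (λ a s → true ∷ a ∷ s) (¬-not (λ b'≡b → b≢b' (sym b'≡b))) (sym r≡r')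

twist-match : ∀ k → suc (suc (suc k)) % 3 ≡ 0 →
              ∀ c x → Adj (suc (suc (suc k))) (c ∷ x) (not c ∷ twist x)
twist-match k 3∣n false x = twist-cross k 3∣n x
twist-match k 3∣n true x = cross-sym (suc (suc k)) x (twist x) (twist-cross k 3∣n x)

twist-matched : ∀ k → suc (suc (suc k)) % 3 ≡ 0 →
                ∀ c {x y} → Adj (suc (suc (suc k))) (c ∷ x) (not c ∷ y) → y ≡ twist x
twist-matched k 3∣n false e = twist-cross-unique k 3∣n e
twist-matched k 3∣n true {x} {y} e = twist-cross-unique k 3∣n (cross-sym (suc (suc k)) y x e)

-- Negating the leading bit of both end points maps edges to edges: it swaps
-- the halves of VQ_{k+1}, and the edges between them are symmetric.
negateHead-preserves : ∀ k b b' (r r' : Vertex k) → Adj (suc k) (b ∷ r) (b' ∷ r') →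
                       Adj (suc k) (not b ∷ r) (not b' ∷ r')
negateHead-preserves k false false r r' e = e
negateHead-preserves k true true r r' e = e
negateHead-preserves k false true r r' e = cross-sym k r r' e
negateHead-preserves k true false r r' e = cross-sym k r' r e

twist-preserves : ∀ k {x y : Vertex (suc (suc k))} → Adj (suc (suc k)) x y → head x ≡ head y →
                  Adj (suc (suc k)) (twist x) (twist y)
twist-preserves k {false ∷ _ ∷ _} {false ∷ _ ∷ _} e refl = e
twist-preserves k {true ∷ b ∷ r} {true ∷ b' ∷ r'} e refl = negateHead-preserves k b b' r r' e

strong⇒pancyclic : ∀ {m} → StronglyPancyclic m → EdgePancyclic (suc m)
strong⇒pancyclic strong = fromLong (λ e lg ℓ≤ → proj₁ (strong e lg ℓ≤))

-- Inside a half the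
-- twist only preserves edges within the halves of VQ_m, so the detour for
-- ℓ > 2^m replaces the closing edge of a cycle that closes in its own half.
stepTwisted : ∀ k → suc (suc (suc k)) % 3 ≡ 0 → 8 ≤ 2 ^ suc (suc k) →
              StronglyPancyclic (suc k) → HasPentagons (suc k) → EdgePancyclic (suc (suc (suc k)))
stepTwisted k 3∣n 8≤N strong pentagon = fromLong longCycles
  where
  m : ℕ
  m = suc (suc k)
  open Splice m twist (twist-match k 3∣n)

  pancyclic : EdgePancyclic m
  pancyclic = strong⇒pancyclic strong

  pentagons : Pentagons
  pentagons (c ∷ x) with y , C ← pentagon x = c ∷ y , liftCycle (suc k) c C , twisted
    where
    twisted : Adj m (twist (c ∷ y)) (twist (c ∷ x))
    twisted = twist-preserves k {c ∷ y} {c ∷ x}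
                (adj-inHalf (suc k) c (adj-sym (suc k) {x} {y} (firstEdge C))) refl

  LongCycles : Vertex (suc m) → Vertex (suc m) → Set
  LongCycles u v = ∀ {ℓ} → Long ℓ → ℓ ≤ 2 ^ suc m → Cycle (suc m) u v ℓ

  inside : ∀ c {x y} → Adj m x y → LongCycles (c ∷ x) (c ∷ y)
  inside c {x} {y} e {ℓ} lg ℓ≤2N with ℓ ≤? 2 ^ m
  ... | yes ℓ≤N = liftCycle m c (pancyclic e (long lg) ℓ≤N)
  ... | no ℓ≰N = spliced (splitAbove 8≤N (≰⇒> ℓ≰N) ℓ≤2N)
    where
    spliced : ∀ {ℓ} → Split (6 ≤_) (2 ^ m) ℓ → Cycle (suc m) (c ∷ x) (c ∷ y) ℓ
    spliced (split a b refl 6≤a a≤N adm-b b≤N) with C , closesIn ← strong e (big 6≤a) a≤N =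
      replaceLast c C (pancyclic twisted adm-b b≤N)
      where
      w : Vertex m
      w = Cycle.last C
      twisted : Adj m (twist x) (twist w)
      twisted = adj-sym m {twist w} (twist-preserves k {w} {x} (Cycle.closes C) closesIn)

  longCycles : ∀ {u v} → Adj (suc m) u v → LongCycles u v
  longCycles = byEdgeType (twist-matched k 3∣n) {LongCycles} inside
                 (λ c x lg ℓ≤ → proj₁ (crossLong 8≤N pancyclic pentagons c x lg ℓ≤))

_≟_ : ∀ {n} → (x y : Vertex n) → Dec (x ≡ y)
_≟_ = ≡-dec _≟ᵇ_

pair? : ∀ a b c d → Dec (PairRel a b c d)
pair? false b false d = b ≟ᵇ d
pair? true b true d = ¬? (b ≟ᵇ d)
pair? false b true d = no λ ()
pair? true b false d = no λ ()

cross? : ∀ m (x y : Vertex m) → Dec (CrossAdj m x y)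
cross? m x y with suc m % 3
cross? m x y | suc _ = x ≟ y
cross? zero x y | zero = no λ ()
cross? (suc zero) x y | zero = no λ ()
cross? (suc (suc k)) (a ∷ b ∷ r) (c ∷ d ∷ s) | zero = pair? a b c d ×-dec (r ≟ s)

adj? : ∀ n (x y : Vertex n) → Dec (Adj n x y)
adj? zero x y = no λ ()
adj? (suc m) (false ∷ x) (false ∷ y) = adj? m x y
adj? (suc m) (true ∷ x) (true ∷ y) = adj? m x y
adj? (suc m) (false ∷ x) (true ∷ y) = cross? m x y
adj? (suc m) (true ∷ x) (false ∷ y) = cross? m y x

admissible? : ∀ ℓ → Dec (Admissible ℓ)
admissible? 0 = no λ { (long (big ())) }
admissible? 1 = no λ { (long (big (s≤s ()))) }
admissible? 2 = yes two
admissible? 3 = no λ { (long (big (s≤s (s≤s (s≤s ()))))) }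
admissible? 4 = yes (long four)
admissible? 5 = no λ { (long (big (s≤s (s≤s (s≤s (s≤s (s≤s ()))))))) }
admissible? (suc (suc (suc (suc (suc (suc ℓ)))))) = yes (long (big (m≤m+n 6 ℓ)))

allVertices : ∀ n → List (Vertex n)
allVertices zero = [] List.∷ List.[]
allVertices (suc n) = map (false ∷_) (allVertices n) ++ map (true ∷_) (allVertices n)

allVertices-complete : ∀ n (x : Vertex n) → x ∈ allVertices n
allVertices-complete zero [] = here refl
allVertices-complete (suc n) (false ∷ x) = ∈-++⁺ˡ (∈-map⁺ (false ∷_) (allVertices-complete n x))
allVertices-complete (suc n) (true ∷ x) =
  ∈-++⁺ʳ (map (false ∷_) (allVertices n)) (∈-map⁺ (true ∷_) (allVertices-complete n x))

endOf : ∀ {A : Set} → A → List A → A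
endOf x List.[] = x
endOf x (y List.∷ ys) = endOf y ys

walk? : ∀ n (x : Vertex n) xs → Dec (Walk (Adj n) x xs (endOf x xs))
walk? n x List.[] = yes []
walk? n x (y List.∷ ys) =
  map′ (λ (e , p) → e ∷ p) (λ { (e ∷ p) → e , p }) (adj? n x y ×-dec walk? n y ys)

Closes : ∀ n (u v : Vertex n) → List (Vertex n) → ℕ → Set
Closes n u v rest ℓ = Walk (Adj n) u (v List.∷ rest) (endOf v rest) × Adj n (endOf v rest) u ×
                      Unique (u List.∷ v List.∷ rest) × length (u List.∷ v List.∷ rest) ≡ ℓ

closes? : ∀ n u v rest ℓ → Dec (Closes n u v rest ℓ)
closes? n u v rest ℓ = walk? n u (v List.∷ rest) ×-dec adj? n (endOf v rest) u ×-dec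
                       UniqueDec.unique? _≟_ (u List.∷ v List.∷ rest) ×-dec
                       (length (u List.∷ v List.∷ rest) ℕ.≟ ℓ)

closes⇒cycle : ∀ {n u v rest ℓ} → Closes n u v rest ℓ → Cycle n u v ℓ
closes⇒cycle {rest = rest} (p , e , distinct , size) = cycle rest _ p e distinct size

-- Candidates for the rest of a cycle: the simple paths with k more
-- vertices from v avoiding `seen`.  The search is not trusted: every
-- candidate used is checked by `closes?`.
paths : ∀ n → ℕ → List (Vertex n) → Vertex n → List (List (Vertex n))
paths n zero seen v = List.[] List.∷ List.[]
paths n (suc k) seen v =
  concatMap (λ x → map (x List.∷_) (paths n k (x List.∷ seen) x))
            (filter (λ x → adj? n v x ×-dec ¬? (Any.any? (x ≟_) seen)) (allVertices n))

Found : ∀ n → Vertex n → Vertex n → ℕ → Set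
Found n u v ℓ = Any (λ rest → Closes n u v rest ℓ) (paths n (ℓ ∸ 2) (v List.∷ u List.∷ List.[]) v)

found? : ∀ n u v ℓ → Dec (Found n u v ℓ)
found? n u v ℓ = Any.any? (λ rest → closes? n u v rest ℓ) _

found⇒cycle : ∀ {n u v ℓ} → Found n u v ℓ → Cycle n u v ℓ
found⇒cycle found = closes⇒cycle (proj₂ (Any.satisfied found))

Certified : ℕ → Set
Certified n = All (λ u → All (λ v → Adj n u v →
                All (λ ℓ → Admissible ℓ → Found n u v ℓ) (upTo (suc (2 ^ n))))
              (allVertices n)) (allVertices n)

certified? : ∀ n → Dec (Certified n)
certified? n = All.all? (λ u → All.all? (λ v → adj? n u v →-dec
                 All.all? (λ ℓ → admissible? ℓ →-dec found? n u v ℓ) _) _) _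

certified⇒pancyclic : ∀ n → Certified n → EdgePancyclic n
certified⇒pancyclic n certificate {u} {v} e {ℓ} adm ℓ≤ = found⇒cycle
  (All.lookup (All.lookup (All.lookup certificate (allVertices-complete n u)) (allVertices-complete n v) e)
              (∈-upTo⁺ (s≤s ℓ≤)) adm)

PentagonCertified : ℕ → Set
PentagonCertified n = All (λ x → Any (λ y → Found n x y 5) (allVertices n)) (allVertices n)

pentagonCertified? : ∀ n → Dec (PentagonCertified n)
pentagonCertified? n = All.all? (λ x → Any.any? (λ y → found? n x y 5) _) _

certified⇒pentagons : ∀ n → PentagonCertified n → HasPentagons n
certified⇒pentagons n certificate x
  with y , found ← Any.satisfied (All.lookup certificate (allVertices-complete n x)) =
  y , found⇒cycle found

pancyclic₂ : EdgePancyclic 2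
pancyclic₂ = certified⇒pancyclic 2 (toWitness {a? = certified? 2} tt)

pancyclic₃ : EdgePancyclic 3
pancyclic₃ = certified⇒pancyclic 3 (toWitness {a? = certified? 3} tt)

pentagons₃ : HasPentagons 3
pentagons₃ = certified⇒pentagons 3 (toWitness {a? = pentagonCertified? 3} tt)

-- The steps need room for the splitting arithmetic: 2^m ≥ 8, i.e. m ≥ 3.
8≤2^[3+k] : ∀ k → 8 ≤ 2 ^ (3 + k)
8≤2^[3+k] zero = ≤-refl
8≤2^[3+k] (suc k) = ≤-trans (8≤2^[3+k] k) (m≤m+n (2 ^ (3 + k)) _)

-- What the recursion carries from one multiple of 3 to the next.
Stage : ℕ → Set
Stage n = EdgePancyclic n × HasPentagons n

period : ∀ q → Stage (3 + q * 3) →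
         EdgePancyclic (4 + q * 3) × EdgePancyclic (5 + q * 3) × Stage (6 + q * 3)
period q (pancyclic , pentagons) =
  strong⇒pancyclic strong₄ , strong⇒pancyclic strong₅ ,
  stepTwisted (3 + q * 3) ([m+kn]%n≡m%n 6 q 3) (8≤2^[3+k] (2 + q * 3)) strong₅ pentagons₄ ,
  liftPentagons (liftPentagons pentagons₄)
  where
  pentagons₄ : HasPentagons (4 + q * 3)
  pentagons₄ = liftPentagons pentagons
  strong₄ : StronglyPancyclic (3 + q * 3)
  strong₄ = stepPlain (3 + q * 3) 0 ([m+kn]%n≡m%n 4 q 3) (8≤2^[3+k] (q * 3)) pancyclic pentagons
  strong₅ : StronglyPancyclic (4 + q * 3)
  strong₅ = stepPlain (4 + q * 3) 1 ([m+kn]%n≡m%n 5 q 3) (8≤2^[3+k] (1 + q * 3))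
                      (strong⇒pancyclic strong₄) pentagons₄

stage : ∀ q → Stage (3 + q * 3)
stage zero = pancyclic₃ , pentagons₃
stage (suc q) = proj₂ (proj₂ (period q (stage q)))

edgePancyclic : ∀ n → 2 ≤ n → EdgePancyclic n
edgePancyclic 1 (s≤s ())
edgePancyclic 2 _ = pancyclic₂
edgePancyclic (suc (suc (suc k))) _ =
  subst (λ i → EdgePancyclic (3 + i)) (sym (m≡m%n+[m/n]*n k 3)) (byResidue (k % 3) (m%n<n k 3))
  where
  byResidue : ∀ r → r < 3 → EdgePancyclic (3 + (r + (k / 3) * 3))
  byResidue 0 _ = proj₁ (stage (k / 3))
  byResidue 1 _ = proj₁ (period (k / 3) (stage (k / 3)))
  byResidue 2 _ = proj₁ (proj₂ (period (k / 3) (stage (k / 3))))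
  byResidue (suc (suc (suc _))) (s≤s (s≤s (s≤s ())))

longLength : ∀ {ℓ} → 4 ≤ ℓ → ℓ ≢ 5 → Long ℓ
longLength {1} (s≤s ()) _
longLength {2} (s≤s (s≤s ())) _
longLength {3} (s≤s (s≤s (s≤s ()))) _
longLength {4} _ _ = four
longLength {5} _ ℓ≢5 = ⊥-elim (ℓ≢5 refl)
longLength {suc (suc (suc (suc (suc (suc ℓ)))))} _ _ = big (m≤m+n 6 ℓ)

theorem3p1 : (∀ (n : ℕ) → 2 ≤ n → (u v : Vertex n) → Adj n u v →
                 ∀ (ℓ : ℕ) → 4 ≤ ℓ → ℓ ≤ 2 ^ n → ℓ ≢ 5 → CycleThroughEdge n u v ℓ)
             × (∀ (n : ℕ) → 3 ≤ n → (u v : Vertex n) → Adj n u v →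
                 ∀ (ℓ : ℕ) → 6 ≤ ℓ → ℓ ≤ 2 ^ n → CycleThroughEdge n u v ℓ)
theorem3p1 =
  (λ n 2≤n u v e ℓ 4≤ℓ ℓ≤2ⁿ ℓ≢5 →
     toCycleThroughEdge (edgePancyclic n 2≤n e (long (longLength 4≤ℓ ℓ≢5)) ℓ≤2ⁿ)) ,
  (λ n 3≤n u v e ℓ 6≤ℓ ℓ≤2ⁿ →
     toCycleThroughEdge (edgePancyclic n (≤-trans (lit≤ 2 3) 3≤n) e (long (big 6≤ℓ)) ℓ≤2ⁿ))
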